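{- Let $\mathsf L$ be any modal system, $P\subseteq\mathcal P$ finite, $k\in\mathbb N$ and $\delta\in D^P_k(\mathsf L)$. Let $\phi\in\mathcal L_{\mathbf D}$ with $dep(\phi)\le k$ and all atoms of $\phi$ in $P$. Then either $\delta\models_{\mathsf L}\phi$ or $\delta\models_{\mathsf L}\neg\phi$.
   Context: Fix a finite nonempty set $\mathcal A$ of agents and a countable set $\mathcal P$ of atoms; $\mathcal P^+(\mathcal A)$ is the set of nonempty subsets of $\mathcal A$. $\mathcal L_{\mathbf D}$: $\phi ::= p \mid \neg\phi \mid \phi\wedge\phi \mid \phi\vee\phi \mid \mathbf{K}_i\phi \mid \mathbf{D}_{\mathcal{B}}\phi$, interpreted on models $(S,R,V)$ with $\mathbf K_i$ the box for $R_i$ and $\mathbf D_{\mathcal B}$ the box for $R_{\mathcal B}=\bigcap_{i\in\mathcal B}R_i$; $\hat{\mathbf D}_{\mathcal B}=\neg\mathbf D_{\mathcal B}\neg$. $dep(\phi)$ is the modal depth (maximal nesting of modal operators). A modal system $\mathsf L$ is given by a class of models ($\mathsf K_n\mathbf D$: all; $\mathsf D_n\mathbf D$: serial; $\mathsf T_n\mathbf D$: reflexive; $\mathsf{K45}_n\mathbf D$: transitive Euclidean; $\mathsf{KD45}_n\mathbf D$: serial transitive Euclidean; $\mathsf{S5}_n\mathbf D$: reflexive transitive Euclidean relations $R_i$); $\models_{\mathsf L}$ and $\mathsf L$-satisfiability are relative to it. For a finite set $\Phi$ let $\nabla_{\mathcal B}\Phi=\mathbf D_{\mathcal B}(\bigvee\Phi)\wedge\bigwedge\{\hat{\mathbf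 D}_{\mathcal B}\phi\mid\phi\in\Phi\}$ (empty disjunction $\bot$, empty conjunction $\top$). $D^P_0$ is the set of minterms of $P$ (conjunctions containing exactly one of $q,\neg q$ for each $q\in P$); $D^P_{k+1}$ is the set of formulas $\delta_0\wedge\bigwedge_{\mathcal B\in\mathcal P^+(\mathcal A)}\nabla_{\mathcal B}\Phi_{\mathcal B}$ with $\delta_0\in D^P_0$ and $\Phi_{\mathcal B}\subseteq D^P_k$. $D^P_k(\mathsf L)$ is the set of $\mathsf L$-satisfiable members of $D^P_k$. -}

module Defs where

open import Level using (0ℓ) renaming (suc to lsuc)
open import Data.Nat using (ℕ; zero; suc; _⊔_)
open import Data.Bool using (Bool; true; false)
open import Data.Fin using (Fin)
open import Data.Fin.Subset using (Subset; Nonempty; _∈_; inside; outside)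
open import Data.Fin.Subset.Properties using (nonempty?)
open import Data.Vec using ([]; _∷_)
open import Data.List using (List; []; _∷_; [_]; map; _++_; mapMaybe)
open import Data.List.Relation.Unary.All using (All)
open import Data.Maybe using (Maybe; just; nothing)
open import Data.Product using (Σ; ∃; _×_; _,_)
open import Data.Sum using (_⊎_)
open import Data.Empty renaming (⊥ to Empty)
open import Relation.Nullary using (yes; no)

-- Agents are Fin n (n nonzero is imposed in the statement); atoms are ℕ.
-- A coalition B is a nonempty subset of the agents.

module _ {n : ℕ} where

  data Fm : Set where
    atom : ℕ → Fm
    ¬_   : Fm → Fm
    _∧_  : Fm → Fm → Fm
    _∨_  : Fm → Fm → Fm
    K    : Fin n → Fm → Fm
    D    : (B : Subset n) → Nonempty B → Fm → Fm

  infixr 6 _∧_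
  infixr 5 _∨_

  ⊥F : Fm
  ⊥F = atom 0 ∧ ¬ atom 0

  ⊤F : Fm
  ⊤F = ¬ ⊥F

  D̂ : (B : Subset n) → Nonempty B → Fm → Fm
  D̂ B ne φ = ¬ D B ne (¬ φ)

  dep : Fm → ℕ
  dep (atom p) = 0
  dep (¬ φ) = dep φ
  dep (φ ∧ ψ) = dep φ ⊔ dep ψ
  dep (φ ∨ ψ) = dep φ ⊔ dep ψ
  dep (K i φ) = suc (dep φ)
  dep (D B ne φ) = suc (dep φ)

  atoms : Fm → List ℕ
  atoms (atom p) = [ p ]
  atoms (¬ φ) = atoms φ
  atoms (φ ∧ ψ) = atoms φ ++ atoms ψ
  atoms (φ ∨ ψ) = atoms φ ++ atoms ψ
  atoms (K i φ) = atoms φ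
  atoms (D B ne φ) = atoms φ

  ⋀ : List Fm → Fm
  ⋀ [] = ⊤F
  ⋀ (φ ∷ []) = φ
  ⋀ (φ ∷ ψ ∷ φs) = φ ∧ ⋀ (ψ ∷ φs)

  ⋁ : List Fm → Fm
  ⋁ [] = ⊥F
  ⋁ (φ ∷ []) = φ
  ⋁ (φ ∷ ψ ∷ φs) = φ ∨ ⋁ (ψ ∷ φs)

  ∇ : (B : Subset n) → Nonempty B → List Fm → Fm
  ∇ B ne Φ = D B ne (⋁ Φ) ∧ ⋀ (map (D̂ B ne) Φ)

  record Model : Set₁ where
    field
      S : Set
      R : Fin n → S → S → Set
      V : ℕ → S → Set

  open Model public

  RB : (M : Model) → Subset n → S M → S M → Set
  RB M B s t = ∀ i → i ∈ B → R M i s t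

  _,_⊨_ : (M : Model) → S M → Fm → Set
  M , s ⊨ atom p = V M p s
  M , s ⊨ (¬ φ) = M , s ⊨ φ → Empty
  M , s ⊨ (φ ∧ ψ) = (M , s ⊨ φ) × (M , s ⊨ ψ)
  M , s ⊨ (φ ∨ ψ) = (M , s ⊨ φ) ⊎ (M , s ⊨ ψ)
  M , s ⊨ K i φ = ∀ t → R M i s t → M , t ⊨ φ
  M , s ⊨ D B ne φ = ∀ t → RB M B s t → M , t ⊨ φ

  Serial Reflexive Transitive Euclidean : Model → Set
  Serial M = ∀ i s → ∃ λ t → R M i s t
  Reflexive M = ∀ i s → R M i s s
  Transitive M = ∀ i s t u → R M i s t → R M i t u → R M i s u
  Euclidean M = ∀ i s t u → R M i s t → R M i s u → R M i t u

  data Unit1 : Set where tt : Unit1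

  data System : Set where
    Kn Dn Tn K45n KD45n S5n : System

  InClass : System → Model → Set
  InClass Kn M = Unit1
  InClass Dn M = Serial M
  InClass Tn M = Reflexive M
  InClass K45n M = Transitive M × Euclidean M
  InClass KD45n M = Serial M × Transitive M × Euclidean M
  InClass S5n M = Reflexive M × Transitive M × Euclidean M

  _⊨[_]_ : Fm → System → Fm → Set₁
  δ ⊨[ L ] φ = (M : Model) → InClass L M → (s : S M) → M , s ⊨ δ → M , s ⊨ φ

  Satisfiable : System → Fm → Set₁
  Satisfiable L δ = Σ Model λ M → InClass L M × Σ (S M) λ s → M , s ⊨ δ

  lit : (ℕ → Bool) → ℕ → Fm
  lit f q with f q
  ... | true = atom q
  ... | false = ¬ atom q

  minterm : List ℕ → (ℕ → Bool) → Fm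
  minterm P f = ⋀ (map (lit f) P)

allSubsets : (n : ℕ) → List (Subset n)
allSubsets zero = [] ∷ []
allSubsets (suc n) = map (outside ∷_) (allSubsets n) ++ map (inside ∷_) (allSubsets n)

NESubset : ℕ → Set
NESubset n = Σ (Subset n) Nonempty

neSubsets : (n : ℕ) → List (NESubset n)
neSubsets n = mapMaybe tag (allSubsets n)
  where
  tag : Subset n → Maybe (NESubset n)
  tag B with nonempty? B
  ... | yes ne = just (B , ne)
  ... | no _ = nothing

module _ {n : ℕ} where

  data InD (P : List ℕ) : ℕ → Fm {n} → Set where
    d0 : (f : ℕ → Bool) → InD P 0 (minterm P f)
    dsuc : ∀ {k} (f : ℕ → Bool) (Φ : NESubset n → List (Fm {n})) →
           (∀ B → All (InD P k) (Φ B)) →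
           InD P (suc k) (minterm P f ∧ ⋀ (map (λ { (B , ne) → ∇ B ne (Φ (B , ne)) }) (neSubsets n)))

  InDL : System {n} → List ℕ → ℕ → Fm {n} → Set₁
  InDL L P k δ = InD P k δ × Satisfiable L δ

-- Induction on φ, for an arbitrary class of models. Atoms are settled by the minterm
-- conjunct of δ, and the Boolean connectives preserve being settled. For D_B φ, δ has a
-- conjunct ∇_B Φ with Φ ⊆ D^P_{k-1}, and by induction each ψ ∈ Φ settles φ uniformly over
-- the class: if every ψ entails φ then so does every R_B-successor of a δ-state, and if
-- some ψ entails ¬ φ then D̂_B ψ refutes D_B φ. Finally K_i φ is equivalent to D_{i} φ.
module Submission where

open import Defs
open import Data.Nat using (ℕ; _≤_; NonZero; suc; s≤s)
open import Data.Nat.Properties using (m⊔n≤o⇒m≤o; m⊔n≤o⇒n≤o)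
open import Data.Bool using (Bool; true; false)
open import Data.Maybe using (Maybe; just)
import Data.Maybe.Relation.Unary.Any as MaybeAny
open import Data.List using (List; []; _∷_; mapMaybe)
open import Data.List.Relation.Unary.All as All using (All; []; _∷_; lookupWith)
open import Data.List.Relation.Unary.All.Properties using (map⁻)
open import Data.List.Relation.Unary.Any using (Any; here; there)
open import Data.List.Relation.Unary.Any.Properties using (gmap; mapMaybe⁺)
open import Data.List.Membership.Propositional using (_∈_)
open import Data.List.Membership.Propositional.Properties using (∈-map⁺; ∈-++⁺ˡ; ∈-++⁺ʳ)
open import Data.List.Relation.Binary.Subset.Propositional using (_⊆_)
open import Data.Fin using (Fin)
open import Data.Fin.Subset using (Subset; Nonempty; inside; outside; ⁅_⁆)
open import Data.Fin.Subset.Properties using (nonempty?; x∈⁅x⁆; x∈⁅y⁆⇒x≡y)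
open import Data.Vec using ([]; _∷_)
open import Data.Product using (∃; _,_; proj₁; proj₂)
open import Data.Sum as Sum using (_⊎_; inj₁; inj₂)
open import Data.Empty using (⊥-elim)
open import Function using (_∘_; _∋_; _⇔_; mk⇔; Equivalence)
open import Relation.Binary.PropositionalEquality using (_≡_; refl; sym; subst)
open import Relation.Nullary using (yes; no)

∈-mapMaybe⁺ : {A B : Set} (f : A → Maybe B) {x : A} {y : B} {xs : List A} →
              x ∈ xs → f x ≡ just y → y ∈ mapMaybe f xs
∈-mapMaybe⁺ f {xs = xs} x∈xs fx≡y =
  mapMaybe⁺ f xs (gmap (λ { refl → subst (MaybeAny.Any (_ ≡_)) (sym fx≡y) (MaybeAny.just refl) }) x∈xs)

∈-allSubsets : ∀ {n} (B : Subset n) → B ∈ allSubsets n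
∈-allSubsets []            = here refl
∈-allSubsets (outside ∷ B) = ∈-++⁺ˡ (∈-map⁺ (outside ∷_) (∈-allSubsets B))
∈-allSubsets (inside ∷ B)  = ∈-++⁺ʳ _ (∈-map⁺ (inside ∷_) (∈-allSubsets B))

-- The normalised type of tagged∈ mentions nonempty? B (through the tagging function
-- inside neSubsets), so the second with refines it.
∈-neSubsets : ∀ {n} (B : Subset n) → Nonempty B → ∃ λ ne → (B , ne) ∈ neSubsets n
∈-neSubsets {n} B ne with (∀ {y} → _ → y ∈ neSubsets n) ∋ ∈-mapMaybe⁺ _ (∈-allSubsets B)
... | tagged∈ with nonempty? B
...   | yes ne′ = ne′ , tagged∈ refl
...   | no ¬ne  = ⊥-elim (¬ne ne)

module _ {n : ℕ} where

  ⊨⋀⇒All : {M : Model {n}} {s : S M} {φs : List Fm} → M , s ⊨ ⋀ φs → All (M , s ⊨_) φs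
  ⊨⋀⇒All {φs = []}         _         = []
  ⊨⋀⇒All {φs = _ ∷ []}     h         = h ∷ []
  ⊨⋀⇒All {φs = _ ∷ _ ∷ _}  (h , hs)  = h ∷ ⊨⋀⇒All hs

  ⊨⋁⇒Any : {M : Model {n}} {s : S M} {φs : List Fm} → M , s ⊨ ⋁ φs → Any (M , s ⊨_) φs
  ⊨⋁⇒Any {φs = []}         (p , ¬p)  = ⊥-elim (¬p p)
  ⊨⋁⇒Any {φs = _ ∷ []}     h         = here h
  ⊨⋁⇒Any {φs = _ ∷ _ ∷ _}  (inj₁ h)  = here h
  ⊨⋁⇒Any {φs = _ ∷ _ ∷ _}  (inj₂ h)  = there (⊨⋁⇒Any h)

  _≋_ : Fm {n} → Fm {n} → Set₁
  φ ≋ ψ = (M : Model) (s : S M) → (M , s ⊨ φ) ⇔ (M , s ⊨ ψ)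

  RB⁅⁆⇔R : (M : Model) (i : Fin n) {s t : S M} → RB M ⁅ i ⁆ s t ⇔ R M i s t
  RB⁅⁆⇔R M i {s} {t} = mk⇔
    (λ rb → rb i (x∈⁅x⁆ i))
    (λ r j j∈⁅i⁆ → subst (λ j → R M j s t) (sym (x∈⁅y⁆⇒x≡y i j∈⁅i⁆)) r)

  D⁅⁆≋K : (i : Fin n) (ne : Nonempty ⁅ i ⁆) (φ : Fm) → D ⁅ i ⁆ ne φ ≋ K i φ
  D⁅⁆≋K i ne φ M s = mk⇔
    (λ □φ t r → □φ t (Equivalence.from (RB⁅⁆⇔R M i) r))
    (λ □φ t r → □φ t (Equivalence.to (RB⁅⁆⇔R M i) r))

  _⊨⟨_⟩_ : Fm {n} → (Model {n} → Set) → Fm {n} → Set₁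
  δ ⊨⟨ C ⟩ φ = (M : Model) → C M → (s : S M) → M , s ⊨ δ → M , s ⊨ φ

  data Decides (C : Model {n} → Set) (δ φ : Fm {n}) : Set₁ where
    entails : δ ⊨⟨ C ⟩ φ → Decides C δ φ
    refutes : δ ⊨⟨ C ⟩ (¬ φ) → Decides C δ φ

  Decides⇒⊎ : {C : Model {n} → Set} {δ φ : Fm {n}} → Decides C δ φ → (δ ⊨⟨ C ⟩ φ) ⊎ (δ ⊨⟨ C ⟩ (¬ φ))
  Decides⇒⊎ (entails δ⊨φ)  = inj₁ δ⊨φ
  Decides⇒⊎ (refutes δ⊨¬φ) = inj₂ δ⊨¬φ

module _ {n : ℕ} {C : Model {n} → Set} where

  ⊨-decides : {δ ψ φ : Fm {n}} → δ ⊨⟨ C ⟩ ψ → Decides C ψ φ → Decides C δ φ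
  ⊨-decides δ⊨ψ (entails ψ⊨φ)  = entails λ M c s → ψ⊨φ M c s ∘ δ⊨ψ M c s
  ⊨-decides δ⊨ψ (refutes ψ⊨¬φ) = refutes λ M c s → ψ⊨¬φ M c s ∘ δ⊨ψ M c s

  decides-resp-≋ : {δ φ ψ : Fm {n}} → φ ≋ ψ → Decides C δ φ → Decides C δ ψ
  decides-resp-≋ φ≋ψ (entails δ⊨φ)  = entails λ M c s → Equivalence.to (φ≋ψ M s) ∘ δ⊨φ M c s
  decides-resp-≋ φ≋ψ (refutes δ⊨¬φ) = refutes λ M c s δs → δ⊨¬φ M c s δs ∘ Equivalence.from (φ≋ψ M s)

  decides-¬ : {δ φ : Fm {n}} → Decides C δ φ → Decides C δ (¬ φ)
  decides-¬ (entails δ⊨φ)  = refutes λ M c s δs ¬φ → ¬φ (δ⊨φ M c s δs)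
  decides-¬ (refutes δ⊨¬φ) = entails δ⊨¬φ

  decides-∧ : {δ φ ψ : Fm {n}} → Decides C δ φ → Decides C δ ψ → Decides C δ (φ ∧ ψ)
  decides-∧ (entails δ⊨φ)  (entails δ⊨ψ)  = entails λ M c s δs → δ⊨φ M c s δs , δ⊨ψ M c s δs
  decides-∧ (refutes δ⊨¬φ) _              = refutes λ M c s δs → δ⊨¬φ M c s δs ∘ proj₁
  decides-∧ _              (refutes δ⊨¬ψ) = refutes λ M c s δs → δ⊨¬ψ M c s δs ∘ proj₂

  decides-∨ : {δ φ ψ : Fm {n}} → Decides C δ φ → Decides C δ ψ → Decides C δ (φ ∨ ψ)
  decides-∨ (entails δ⊨φ)  _              = entails λ M c s δs → inj₁ (δ⊨φ M c s δs)
  decides-∨ _              (entails δ⊨ψ)  = entails λ M c s δs → inj₂ (δ⊨ψ M c s δs)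
  decides-∨ (refutes δ⊨¬φ) (refutes δ⊨¬ψ) = refutes λ M c s δs → Sum.[ δ⊨¬φ M c s δs , δ⊨¬ψ M c s δs ]

  lit-decides-atom : (f : ℕ → Bool) (p : ℕ) → Decides C (lit f p) (atom p)
  lit-decides-atom f p with f p
  ... | true  = entails λ _ _ _ v → v
  ... | false = refutes λ _ _ _ ¬v → ¬v

  minterm-decides-atom : {P : List ℕ} (f : ℕ → Bool) {p : ℕ} → p ∈ P → Decides C (minterm P f) (atom p)
  minterm-decides-atom f {p} p∈P =
    ⊨-decides (λ _ _ _ m → All.lookup (map⁻ (⊨⋀⇒All m)) p∈P) (lit-decides-atom f p)

  InD⇒⊨minterm : {P : List ℕ} {k : ℕ} {δ : Fm {n}} → InD P k δ → ∃ λ f → δ ⊨⟨ C ⟩ minterm P f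
  InD⇒⊨minterm (d0 f)       = f , λ _ _ _ m → m
  InD⇒⊨minterm (dsuc f _ _) = f , λ _ _ _ → proj₁

  all-entail-or-any-refutes : {Φ : List Fm} {φ : Fm {n}} → All (λ ψ → Decides C ψ φ) Φ →
                              All (λ ψ → ψ ⊨⟨ C ⟩ φ) Φ ⊎ Any (λ ψ → ψ ⊨⟨ C ⟩ (¬ φ)) Φ
  all-entail-or-any-refutes []                = inj₁ []
  all-entail-or-any-refutes (refutes ψ⊨¬φ ∷ _) = inj₂ (here ψ⊨¬φ)
  all-entail-or-any-refutes (entails ψ⊨φ ∷ ds) = Sum.map (ψ⊨φ ∷_) there (all-entail-or-any-refutes ds)

  ∇-decides-D : {B : Subset n} {ne ne′ : Nonempty B} {Φ : List Fm} {φ : Fm {n}} →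
                All (λ ψ → Decides C ψ φ) Φ → Decides C (∇ B ne Φ) (D B ne′ φ)
  ∇-decides-D Φ-decides with all-entail-or-any-refutes Φ-decides
  ... | inj₁ all⊨φ  = entails λ { M c s (□⋁Φ , _) t r →
          lookupWith (λ ψ⊨φ ψt → ψ⊨φ M c t ψt) all⊨φ (⊨⋁⇒Any (□⋁Φ t r)) }
  ... | inj₂ some⊨¬φ = refutes λ { M c s (_ , ◇Φ) □φ →
          lookupWith (λ ◇ψ ψ⊨¬φ → ◇ψ λ t r ψt → ψ⊨¬φ M c t ψt (□φ t r)) (map⁻ (⊨⋀⇒All ◇Φ)) some⊨¬φ }

  D-decides : {P : List ℕ} {k : ℕ} {δ φ : Fm {n}} → InD P (suc k) δ →
              (∀ {ψ} → InD P k ψ → Decides C ψ φ) → (B : Subset n) (ne : Nonempty B) → Decides C δ (D B ne φ)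
  D-decides (dsuc f Φ Φ⊆D) ih B ne with ∈-neSubsets B ne
  ... | ne′ , B∈ = ⊨-decides (λ _ _ _ δs → All.lookup (map⁻ (⊨⋀⇒All (proj₂ δs))) B∈)
                             (∇-decides-D (All.map ih (Φ⊆D (B , ne′))))

  decides : {P : List ℕ} {k : ℕ} {δ : Fm {n}} → InD P k δ →
            (φ : Fm {n}) → dep φ ≤ k → atoms φ ⊆ P → Decides C δ φ
  decides δ∈D (atom p) _ ⊆P =
    let f , δ⊨m = InD⇒⊨minterm δ∈D in ⊨-decides δ⊨m (minterm-decides-atom f (⊆P (here refl)))
  decides δ∈D (¬ φ) d≤k ⊆P = decides-¬ (decides δ∈D φ d≤k ⊆P)
  decides δ∈D (φ ∧ ψ) d≤k ⊆P = decides-∧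
    (decides δ∈D φ (m⊔n≤o⇒m≤o (dep φ) _ d≤k) (⊆P ∘ ∈-++⁺ˡ))
    (decides δ∈D ψ (m⊔n≤o⇒n≤o (dep φ) _ d≤k) (⊆P ∘ ∈-++⁺ʳ (atoms φ)))
  decides δ∈D (φ ∨ ψ) d≤k ⊆P = decides-∨
    (decides δ∈D φ (m⊔n≤o⇒m≤o (dep φ) _ d≤k) (⊆P ∘ ∈-++⁺ˡ))
    (decides δ∈D ψ (m⊔n≤o⇒n≤o (dep φ) _ d≤k) (⊆P ∘ ∈-++⁺ʳ (atoms φ)))
  decides (d0 _) (K _ _) ()
  decides δ∈D@(dsuc _ _ _) (K i φ) (s≤s d≤k) ⊆P = decides-resp-≋ (D⁅⁆≋K i ne φ)
    (D-decides δ∈D (λ ψ∈D → decides ψ∈D φ d≤k ⊆P) ⁅ i ⁆ ne)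
    where
    ne : Nonempty ⁅ i ⁆
    ne = i , x∈⁅x⁆ i
  decides (d0 _) (D _ _ _) ()
  decides δ∈D@(dsuc _ _ _) (D B ne φ) (s≤s d≤k) ⊆P =
    D-decides δ∈D (λ ψ∈D → decides ψ∈D φ d≤k ⊆P) B ne

proposition3p8 : {n : ℕ} → .{{_ : NonZero n}} → (L : System {n}) (P : List ℕ) (k : ℕ) (δ : Fm {n}) → InDL L P k δ → (φ : Fm {n}) → dep φ ≤ k → atoms φ ⊆ P → (δ ⊨[ L ] φ) ⊎ (δ ⊨[ L ] (¬ φ))
proposition3p8 L P k δ (δ∈D , _) φ d≤k ⊆P = Decides⇒⊎ (decides {C = InClass L} δ∈D φ d≤k ⊆P)
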